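{- For any binary string $S$ and any symbol $c\in\{0,1\}$, $VCdim(cS)\leq VCdim(S)+1$ and $VCdim(Sc)\leq VCdim(S)+1$.
   Context: For a finite binary string $s$ (indexed from $0$), $n(s)=\{i: s_i=1\}$; for a binary string $S$, $\mathfrak{S}=\{n(s): s \text{ a finite contiguous substring of } S\}$; a set $B\subseteq\mathbb{N}$ is shattered if $\{c\cap B: c\in\mathfrak{S}\}$ is the power set of $B$; $VCdim(S)$ is the largest size of a shattered set. Juxtaposition denotes concatenation. -}

module Defs where

open import Data.Bool using (Bool; true; false)
open import Data.Nat using (ℕ; zero; suc; _≤_)
open import Data.List using (List; []; _∷_; _++_; length)
open import Data.List.Membership.Propositional using (_∈_)
open import Data.List.Relation.Unary.Unique.Propositional using (Unique)
open import Data.Product using (Σ; _×_; ∃; ∃-syntax)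
open import Relation.Binary.PropositionalEquality using (_≡_)
open import Function.Bundles using (_⇔_)

-- Finite binary strings, indexed from 0; 1 = true, 0 = false.
BinStr : Set
BinStr = List Bool

-- i-th symbol of s (false = 0 outside the string; irrelevant for membership in n(s)).
symAt : BinStr → ℕ → Bool
symAt []       _       = false
symAt (b ∷ s)  zero    = b
symAt (b ∷ s)  (suc i) = symAt s i

_∈n_ : ℕ → BinStr → Set
i ∈n s = symAt s i ≡ true

Substring : BinStr → BinStr → Set
Substring s S = ∃[ u ] ∃[ v ] (u ++ s ++ v ≡ S)

-- A finite set B ⊆ ℕ (duplicate-free list) is shattered by S:
-- every subset A ⊆ B (given by a characteristic function) arises as n(s) ∩ B
-- for some finite contiguous substring s of S.
Shattered : BinStr → List ℕ → Set
Shattered S B =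
  (A : ℕ → Bool) →
  Σ BinStr λ s → Substring s S × ((x : ℕ) → x ∈ B → (x ∈n s ⇔ (A x ≡ true)))

IsVCdim : BinStr → ℕ → Set
IsVCdim S d =
  (Σ (List ℕ) λ B → Unique B × length B ≡ d × Shattered S B)
  × ((B : List ℕ) → Unique B → Shattered S B → length B ≤ d)

-- Deleting a suitable point from a set B shattered by cS or Sc leaves a set shattered by S.
-- For cS delete the least element m and realise a pattern A on the rest twice in cS, with m ↦ 0
-- and with m ↦ 1; if either substring avoids the leading c we are done. Otherwise both are
-- prefixes of cS and (unless A is empty) both reach past m, so they carry the same symbol at m,
-- which is impossible. For Sc delete the greatest element M and realise A with M ↦ 1: a substring
-- ending in the new c still reaches M, so dropping its last symbol keeps every index below M.
module Submission where

open import Defs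
open import Data.Bool using (Bool; true; false; _≟_)
open import Data.Nat using (ℕ; zero; suc; _≤_; _<_; z≤n; s≤s)
open import Data.Nat.Properties
  using (≤-trans; ≤-total; <-trans; <-≤-trans; ≤∧≢⇒<; <⇒≢; >⇒≢; m<1+n⇒m≤n; +-comm)
  renaming (_≟_ to _≟ℕ_)
open import Relation.Binary.PropositionalEquality
  using (_≡_; _≢_; refl; sym; cong; subst; setoid; ≢-sym)
  renaming (trans to ≡-trans)
open import Data.List using (List; []; _∷_; _++_; [_]; _∷ʳ_; length; initLast; InitLast)
open import Data.List.Properties using (∷ʳ-injective; ++-assoc; ++-identityʳ; length-++)
open import Data.List.Relation.Unary.All as All using (All; []; _∷_)
open import Data.List.Relation.Unary.AllPairs using (_∷_)
open import Data.List.Relation.Unary.Any using (here; there; any?)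
open import Data.List.Membership.Propositional using (_∈_; lose; find)
open import Data.List.Relation.Unary.Unique.Propositional using (Unique)
open import Data.List.Relation.Binary.Subset.Propositional using (_⊆_)
open import Data.List.Relation.Binary.Permutation.Propositional using (_↭_; refl; prep; swap; trans; ↭-sym; ↭⇒↭ₛ)
open import Data.List.Relation.Binary.Permutation.Propositional.Properties using (↭-length; ∈-resp-↭)
open import Data.List.Relation.Binary.Permutation.Setoid.Properties (setoid ℕ) using (Unique-resp-↭)
open import Data.Product using (∃₂; ∃-syntax; _×_; _,_; proj₁; uncurry)
open import Data.Sum using (_⊎_; inj₁; inj₂)
open import Function using (_∘_; flip)
open import Function.Bundles using (_⇔_; mk⇔; Equivalence)
open import Level using (0ℓ)
open import Relation.Binary using (Rel; Transitive; Total)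
open import Relation.Nullary using (yes; no; contradiction)

open Equivalence using (to; from)

HasTrace : BinStr → List ℕ → (ℕ → Bool) → Set
HasTrace s B A = (x : ℕ) → x ∈ B → (x ∈n s ⇔ A x ≡ true)

hasTrace-⊆ : ∀ s {B B′ A A′} → B ⊆ B′ → (∀ {x} → x ∈ B → A′ x ≡ A x) →
             HasTrace s B′ A′ → HasTrace s B A
hasTrace-⊆ s B⊆B′ A′≗A tr x x∈B =
  subst (λ b → x ∈n s ⇔ b ≡ true) (A′≗A x∈B) (tr x (B⊆B′ x∈B))

hasTrace-agree : ∀ s t {B A} → (∀ {x} → x ∈ B → symAt s x ≡ symAt t x) →
                 HasTrace s B A → HasTrace t B A
hasTrace-agree s t {A = A} s≗t tr x x∈B =
  subst (λ b → b ≡ true ⇔ A x ≡ true) (s≗t x∈B) (tr x x∈B)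

shattered-⊆ : ∀ {S B B′} → B ⊆ B′ → Shattered S B′ → Shattered S B
shattered-⊆ B⊆B′ sh A with sh A
... | s , sub , tr = s , sub , hasTrace-⊆ s B⊆B′ (λ _ → refl) tr

_[_≔_] : (ℕ → Bool) → ℕ → Bool → ℕ → Bool
(A [ m ≔ b ]) x with x ≟ℕ m
... | yes _ = b
... | no  _ = A x

[≔]-same : ∀ A m b → (A [ m ≔ b ]) m ≡ b
[≔]-same A m b with m ≟ℕ m
... | yes _  = refl
... | no m≢m = contradiction refl m≢m

[≔]-other : ∀ A {m} b {x} → x ≢ m → (A [ m ≔ b ]) x ≡ A x
[≔]-other A {m} b {x} x≢m with x ≟ℕ m
... | yes x≡m = contradiction x≡m x≢m
... | no  _   = refl

hasTrace-drop : ∀ s {m B A b} → All (_≢ m) B →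
                HasTrace s (m ∷ B) (A [ m ≔ b ]) → HasTrace s B A
hasTrace-drop s {A = A} {b} B≢m = hasTrace-⊆ s there ([≔]-other A b ∘ All.lookup B≢m)

∈n⇒<length : ∀ {i} s → i ∈n s → i < length s
∈n⇒<length {zero}  (b ∷ s) _   = s≤s z≤n
∈n⇒<length {suc i}  (b ∷ s) i∈s = s≤s (∈n⇒<length s i∈s)

symAt-++ˡ : ∀ {i} s v → i < length s → symAt (s ++ v) i ≡ symAt s i
symAt-++ˡ {zero}  (b ∷ s) v _         = refl
symAt-++ˡ {suc i} (b ∷ s) v (s≤s i<s) = symAt-++ˡ s v i<s

symAt-prefix : ∀ s {v T i} → s ++ v ≡ T → i < length s → symAt T i ≡ symAt s i
symAt-prefix s {v} refl = symAt-++ˡ s v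

substring-∷ : ∀ {s c S} → Substring s (c ∷ S) → Substring s S ⊎ ∃[ v ] (s ++ v ≡ c ∷ S)
substring-∷ ([]    , v , s++v≡cS) = inj₂ (v , s++v≡cS)
substring-∷ (_ ∷ u , v , refl)    = inj₁ (u , v , refl)

++-∷ʳ-injective : ∀ {a} {A : Set a} (xs ys : List A) {zs x y} →
                  xs ++ ys ∷ʳ x ≡ zs ∷ʳ y → xs ++ ys ≡ zs × x ≡ y
++-∷ʳ-injective xs ys {x = x} eq = ∷ʳ-injective (xs ++ ys) _ (≡-trans (++-assoc xs ys [ x ]) eq)

substring-∷ʳ : ∀ {s S c} → Substring s (S ∷ʳ c) →
               Substring s S ⊎ ∃[ t ] (s ≡ t ∷ʳ c × Substring t S)
substring-∷ʳ {s} (u , v , eq) with initLast v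
... | v′ InitLast.∷ʳ′ x =
  inj₁ (u , v′ , proj₁ (++-∷ʳ-injective u (s ++ v′)
                          (≡-trans (cong (u ++_) (++-assoc s v′ [ x ])) eq)))
... | InitLast.[] with initLast s
...   | InitLast.[]       = inj₁ ([] , _ , refl)
...   | t InitLast.∷ʳ′ x
          with ++-∷ʳ-injective u t (≡-trans (cong (u ++_) (sym (++-identityʳ (t ∷ʳ x)))) eq)
...     | u++t≡S , refl = inj₂ (t , refl , u , [] , ≡-trans (cong (u ++_) (++-identityʳ t)) u++t≡S)

shattered-∷ : ∀ {c S m B} → All (m <_) B → Shattered (c ∷ S) (m ∷ B) → Shattered S B
shattered-∷ {S = S} {m} {B} m<B sh A with any? (λ x → A x ≟ true) B
... | no  none =
  [] , ([] , S , refl) , λ x x∈B → mk⇔ (λ ()) (λ Ax → contradiction (lose x∈B Ax) none)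
... | yes some with find some | sh (A [ m ≔ false ]) | sh (A [ m ≔ true ])
... | y , y∈B , Ay | s₀ , sub₀ , tr₀ | s₁ , sub₁ , tr₁ with substring-∷ sub₀ | substring-∷ sub₁
... | inj₁ sub₀′ | _           = s₀ , sub₀′ , hasTrace-drop s₀ (All.map >⇒≢ m<B) tr₀
... | inj₂ _     | inj₁ sub₁′  = s₁ , sub₁′ , hasTrace-drop s₁ (All.map >⇒≢ m<B) tr₁
... | inj₂ (_ , pre₀) | inj₂ (_ , pre₁) =
  contradiction (≡-trans (sym ([≔]-same A m false)) (to (tr₀ m (here refl)) m∈s₀)) λ ()
  where
  m∈s₁ : m ∈n s₁
  m∈s₁ = from (tr₁ m (here refl)) ([≔]-same A m true)

  y∈s₀ : y ∈n s₀
  y∈s₀ = from (tr₀ y (there y∈B)) (≡-trans ([≔]-other A false (>⇒≢ (All.lookup m<B y∈B))) Ay)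

  m∈s₀ : m ∈n s₀
  m∈s₀ = ≡-trans (sym (symAt-prefix s₀ pre₀ (<-trans (All.lookup m<B y∈B) (∈n⇒<length s₀ y∈s₀))))
                 (≡-trans (symAt-prefix s₁ pre₁ (∈n⇒<length s₁ m∈s₁)) m∈s₁)

shattered-∷ʳ : ∀ {c S M B} → All (_< M) B → Shattered (S ∷ʳ c) (M ∷ B) → Shattered S B
shattered-∷ʳ {c} {M = M} {B} B<M sh A with sh (A [ M ≔ true ])
... | s , sub , tr with substring-∷ʳ sub
... | inj₁ sub′              = s , sub′ , hasTrace-drop s (All.map <⇒≢ B<M) tr
... | inj₂ (t , refl , sub′) =
  t , sub′ , hasTrace-agree (t ∷ʳ c) t below-M (hasTrace-drop (t ∷ʳ c) (All.map <⇒≢ B<M) tr)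
  where
  M≤|t| : M ≤ length t
  M≤|t| = m<1+n⇒m≤n (subst (M <_) (≡-trans (length-++ t) (+-comm (length t) 1))
            (∈n⇒<length (t ∷ʳ c) (from (tr M (here refl)) ([≔]-same A M true))))

  below-M : ∀ {x} → x ∈ B → symAt (t ∷ʳ c) x ≡ symAt t x
  below-M x∈B = symAt-++ˡ t [ c ] (<-≤-trans (All.lookup B<M x∈B) M≤|t|)

module _ {a ℓ} {A : Set a} {_≼_ : Rel A ℓ} (≼-trans : Transitive _≼_) (≼-total : Total _≼_) where

  extract-least : ∀ x xs → ∃₂ λ m B → x ∷ xs ↭ m ∷ B × All (m ≼_) B
  extract-least x []       = x , [] , refl , []
  extract-least x (y ∷ ys) with extract-least y ys
  ... | m , B , y∷ys↭m∷B , m≼B with ≼-total x m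
  ... | inj₁ x≼m = x , m ∷ B , prep x y∷ys↭m∷B , x≼m ∷ All.map (≼-trans x≼m) m≼B
  ... | inj₂ m≼x = m , x ∷ B , trans (prep x y∷ys↭m∷B) (swap x m refl) , m≼x ∷ m≼B

vcdim-≤-suc : ∀ {T S d} {_≼_ : Rel ℕ 0ℓ} → Transitive _≼_ → Total _≼_ →
  (∀ {m B} → All (m ≼_) B → All (m ≢_) B → Shattered T (m ∷ B) → Shattered S B) →
  IsVCdim S d → (d′ : ℕ) → IsVCdim T d′ → d′ ≤ suc d
vcdim-≤-suc {d = d} ≼-trans ≼-total drop-least (_ , maximal) _ ((B , uniq , refl , sh) , _) with B
... | []     = z≤n
... | x ∷ xs with extract-least ≼-trans ≼-total x xs
... | m , B′ , perm , m≼B′ with Unique-resp-↭ (↭⇒↭ₛ perm) uniq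
... | m≢B′ ∷ uniq′ =
  subst (_≤ suc d) (sym (↭-length perm))
    (s≤s (maximal B′ uniq′ (drop-least m≼B′ m≢B′ (shattered-⊆ (∈-resp-↭ (↭-sym perm)) sh))))

proposition14 : (S : BinStr) (c : Bool) (d : ℕ) → IsVCdim S d →
    ((d₁ : ℕ) → IsVCdim (c ∷ S) d₁ → d₁ ≤ suc d)
    × ((d₂ : ℕ) → IsVCdim (S ++ [ c ]) d₂ → d₂ ≤ suc d)
proposition14 S c d vc =
  vcdim-≤-suc ≤-trans ≤-total least-drops vc ,
  vcdim-≤-suc (flip ≤-trans) (flip ≤-total) greatest-drops vc
  where
  least-drops : ∀ {m B} → All (m ≤_) B → All (m ≢_) B →
                Shattered (c ∷ S) (m ∷ B) → Shattered S B
  least-drops m≤B m≢B = shattered-∷ (All.zipWith (uncurry ≤∧≢⇒<) (m≤B , m≢B))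

  greatest-drops : ∀ {M B} → All (_≤ M) B → All (M ≢_) B →
                   Shattered (S ∷ʳ c) (M ∷ B) → Shattered S B
  greatest-drops B≤M M≢B =
    shattered-∷ʳ (All.zipWith (λ (y≤M , M≢y) → ≤∧≢⇒< y≤M (≢-sym M≢y)) (B≤M , M≢B))
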